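{- Let $\alpha,\beta$ be relatively prime positive integers and let $n$ be a positive integer with $s(n)=s$. Then there exist no integers $a',b'\ge1$ with $n=a'g_s+\beta b'g_{s-1}$. Moreover, a pair $(b,a)$ is $n$-good if and only if $n=a g_{s-1}+\beta b g_{s-2}$ and $a,b\ge1$.
   Context: For positive integers $a_1,a_2$, the $(\alpha,\beta)$-walk $w_k(a_1,a_2)$ is the sequence with $w_1=a_1$, $w_2=a_2$, $w_{k+2}=\alpha w_{k+1}+\beta w_k$ for $k\ge1$. For a positive integer $n$, $s(n;a_1,a_2)$ is the (largest) index $s$ with $w_s(a_1,a_2)=n$ ($-\infty$ if none), and $s(n)=\max_{a_1,a_2\ge1}s(n;a_1,a_2)$. A pair $(a_1,a_2)$ is $n$-good if $a_1,a_2\ge1$ and $s(n;a_1,a_2)=s(n)$. The sequence $g_k$ is defined by $g_1=1$, $g_2=\alpha$, $g_{k+2}=\alpha g_{k+1}+\beta g_k$ for $k\ge1$, with conventions $g_0=0$ and $g_{ -1}=\beta^{ -1}$. -}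

module Defs where

open import Data.Nat using (ℕ; zero; suc; _+_; _*_; _≤_)
open import Data.Product using (Σ; _×_)
open import Relation.Binary.PropositionalEquality using (_≡_)

-- The (α,β)-walk: walk α β a₁ a₂ k = w_k(a₁,a₂) for k ≥ 1.
-- Index 0 is junk (value 0) and is never used: all quantifications over
-- indices below require 1 ≤ k.
walk : ℕ → ℕ → ℕ → ℕ → ℕ → ℕ
walk α β a₁ a₂ zero = 0
walk α β a₁ a₂ (suc zero) = a₁
walk α β a₁ a₂ (suc (suc zero)) = a₂
walk α β a₁ a₂ (suc (suc (suc k))) =
  α * walk α β a₁ a₂ (suc (suc k)) + β * walk α β a₁ a₂ (suc k)

g : ℕ → ℕ → ℕ → ℕ
g α β zero = 0
g α β (suc zero) = 1
g α β (suc (suc k)) = α * g α β (suc k) + β * g α β k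

SIdx : ℕ → ℕ → ℕ → ℕ → ℕ → ℕ → Set
SIdx α β n a₁ a₂ s =
  1 ≤ s × walk α β a₁ a₂ s ≡ n ×
  ((k : ℕ) → 1 ≤ k → walk α β a₁ a₂ k ≡ n → k ≤ s)

SOf : ℕ → ℕ → ℕ → ℕ → Set
SOf α β n s =
  Σ ℕ (λ a₁ → Σ ℕ (λ a₂ → 1 ≤ a₁ × 1 ≤ a₂ × walk α β a₁ a₂ s ≡ n)) ×
  (1 ≤ s) ×
  ((a₁ a₂ k : ℕ) → 1 ≤ a₁ → 1 ≤ a₂ → 1 ≤ k → walk α β a₁ a₂ k ≡ n → k ≤ s)

Good : ℕ → ℕ → ℕ → ℕ → ℕ → Set
Good α β n a₁ a₂ =
  1 ≤ a₁ × 1 ≤ a₂ × Σ ℕ (λ s → SOf α β n s × SIdx α β n a₁ a₂ s)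

{-# OPTIONS --safe #-}
-- Every walk is a linear combination of the g's: w_{k+2}(a₁,a₂) = a₂ g_{k+1} + β a₁ g_k.
-- Walking from (1,n) hits n at index 2, so s(n) = t + 2 for some t. A representation
-- n = a′ g_{t+2} + β b′ g_{t+1} would make (b′,a′) reach n at index t + 3 > s(n); and
-- since s(n) is unique, (b,a) is n-good exactly when its walk reaches n at index t + 2.
module Submission where

open import Defs
open import Data.Nat using (ℕ; zero; suc; _+_; _*_; _∸_; _≤_; s≤s; z≤n)
open import Data.Nat.Properties using (≤-antisym; 1+n≰n)
open import Data.Nat.Coprimality using (Coprime)
open import Data.Nat.Tactic.RingSolver using (solve-∀)
open import Data.Product using (Σ; _×_; _,_)
open import Data.Empty using (⊥)
open import Function.Bundles using (_⇔_; mk⇔; module Equivalence)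
open import Relation.Binary.PropositionalEquality using (_≡_; refl; sym; trans; cong₂; module ≡-Reasoning)

module _ (α β : ℕ) where

  walk-via-g : ∀ a₁ a₂ k →
    walk α β a₁ a₂ (suc (suc k)) ≡ a₂ * g α β (suc k) + β * a₁ * g α β k
  walk-via-g a₁ a₂ zero = base β a₁ a₂
    where
    base : ∀ β a₁ a₂ → a₂ ≡ a₂ * 1 + β * a₁ * 0
    base = solve-∀
  walk-via-g a₁ a₂ (suc zero) = base α β a₁ a₂
    where
    base : ∀ α β a₁ a₂ → α * a₂ + β * a₁ ≡ a₂ * (α * 1 + β * 0) + β * a₁ * 1
    base = solve-∀
  walk-via-g a₁ a₂ (suc (suc k)) = begin
    α * walk α β a₁ a₂ (3 + k) + β * walk α β a₁ a₂ (2 + k)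
      ≡⟨ cong₂ (λ x y → α * x + β * y) (walk-via-g a₁ a₂ (suc k)) (walk-via-g a₁ a₂ k) ⟩
    α * (a₂ * G₂ + β * a₁ * G₁) + β * (a₂ * G₁ + β * a₁ * G₀)
      ≡⟨ regroup α β a₁ a₂ G₂ G₁ G₀ ⟩
    a₂ * (α * G₂ + β * G₁) + β * a₁ * (α * G₁ + β * G₀) ∎
    where
    open ≡-Reasoning
    G₂ = g α β (2 + k)
    G₁ = g α β (1 + k)
    G₀ = g α β k
    regroup : ∀ α β a₁ a₂ x y z →
      α * (a₂ * x + β * a₁ * y) + β * (a₂ * y + β * a₁ * z) ≡
      a₂ * (α * x + β * y) + β * a₁ * (α * y + β * z)
    regroup = solve-∀

  SOf-unique : ∀ {n s s′} → SOf α β n s → SOf α β n s′ → s ≡ s′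
  SOf-unique ((a₁ , a₂ , 1≤a₁ , 1≤a₂ , reach) , 1≤s , max)
             ((a₁′ , a₂′ , 1≤a₁′ , 1≤a₂′ , reach′) , 1≤s′ , max′) =
    ≤-antisym (max′ a₁ a₂ _ 1≤a₁ 1≤a₂ 1≤s reach) (max a₁′ a₂′ _ 1≤a₁′ 1≤a₂′ 1≤s′ reach′)

  SOf⇒2≤s : ∀ {n s} → 1 ≤ n → SOf α β n s → 2 ≤ s
  SOf⇒2≤s 1≤n (_ , _ , max) = max 1 _ 2 (s≤s z≤n) 1≤n (s≤s z≤n) refl

  Good⇔reaches : ∀ {n s a₁ a₂} → SOf α β n s →
    Good α β n a₁ a₂ ⇔ (1 ≤ a₁ × 1 ≤ a₂ × walk α β a₁ a₂ s ≡ n)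
  Good⇔reaches {n} {s} {a₁} {a₂} sof@(_ , 1≤s , max) = mk⇔ to from
    where
    to : Good α β n a₁ a₂ → 1 ≤ a₁ × 1 ≤ a₂ × walk α β a₁ a₂ s ≡ n
    to (1≤a₁ , 1≤a₂ , s′ , sof′ , _ , reach , _) with SOf-unique sof sof′
    ... | refl = 1≤a₁ , 1≤a₂ , reach
    from : 1 ≤ a₁ × 1 ≤ a₂ × walk α β a₁ a₂ s ≡ n → Good α β n a₁ a₂
    from (1≤a₁ , 1≤a₂ , reach) =
      1≤a₁ , 1≤a₂ , s , sof , 1≤s , reach , λ k 1≤k → max a₁ a₂ k 1≤a₁ 1≤a₂ 1≤k

corollary3 : (α β : ℕ) → 1 ≤ α → 1 ≤ β → Coprime α β →
    (n : ℕ) → 1 ≤ n → (s : ℕ) → SOf α β n s →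
    ((Σ ℕ (λ a′ → Σ ℕ (λ b′ → 1 ≤ a′ × 1 ≤ b′ ×
        n ≡ a′ * g α β s + β * b′ * g α β (s ∸ 1)))) → ⊥) ×
    ((b a : ℕ) → Good α β n b a ⇔
      (n ≡ a * g α β (s ∸ 1) + β * b * g α β (s ∸ 2) × 1 ≤ a × 1 ≤ b))
corollary3 α β _ _ _ n 1≤n s sof@(_ , _ , max) with SOf⇒2≤s α β 1≤n sof
... | s≤s (s≤s {n = t} _) = no-representation , good-iff
  where
  no-representation : Σ ℕ (λ a′ → Σ ℕ (λ b′ → 1 ≤ a′ × 1 ≤ b′ ×
    n ≡ a′ * g α β (2 + t) + β * b′ * g α β (1 + t))) → ⊥
  no-representation (a′ , b′ , 1≤a′ , 1≤b′ , eq) =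
    1+n≰n (max b′ a′ (3 + t) 1≤b′ 1≤a′ (s≤s z≤n) (trans (walk-via-g α β b′ a′ (1 + t)) (sym eq)))

  good-iff : (b a : ℕ) → Good α β n b a ⇔
    (n ≡ a * g α β (1 + t) + β * b * g α β t × 1 ≤ a × 1 ≤ b)
  good-iff b a = mk⇔
    (λ good → let 1≤b , 1≤a , reach = to good in
      trans (sym reach) (walk-via-g α β b a t) , 1≤a , 1≤b)
    (λ (eq , 1≤a , 1≤b) → from (1≤b , 1≤a , trans (walk-via-g α β b a t) (sym eq)))
    where open Equivalence (Good⇔reaches α β sof)
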